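{- Let $n,g$ be integers with $0\leq g\leq \left\lfloor \frac{n-3}{2}\right\rfloor$, and let $T_n$ be a tree of order $n$. Then $T_n$ has an $R_g$-cutset with $\kappa_g(T_n)=n-2g-2$ if and only if $T_n$ is isomorphic to a tree of the following form: there are trees $T',T''$ with $|V(T')|=|V(T'')|=g+1$, an integer $r\ge 0$, and trees $T_1,\ldots,T_r$ with $1\le|V(T_i)|\leq g$ for each $i$ and $\sum_{i=1}^r|V(T_i)|=n-2g-3$ (all vertex-disjoint), and the tree is obtained from $T',T'',T_1,\ldots,T_r$ by adding a new vertex $v$ and exactly one edge from $v$ to a vertex of each of $T',T'',T_1,\ldots,T_r$.
   Context: A set $S$ of vertices is a cutset if $G-S$ is disconnected; for a non-negative integer $g$, a cutset is an $R_g$-cutset if every component of $G-S$ has at least $g+1$ vertices. If $G$ has an $R_g$-cutset, $\kappa_g(G)$ is the minimum cardinality of an $R_g$-cutset of $G$. -}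

module Defs where

open import Data.Nat using (ℕ; zero; suc; _+_; _≤_)
open import Data.Bool using (Bool; true; false)
open import Data.Fin using (Fin; zero; suc; splitAt; _≟_)
open import Data.Fin.Subset using (Subset; _∈_; _∉_; ∁; ⊤; ∣_∣)
open import Data.List using (List; []; _∷_; length)
open import Data.List.Relation.Unary.Unique.Propositional using (Unique)
open import Data.Sum using (_⊎_; inj₁; inj₂)
open import Data.Product using (Σ; ∃; _×_; _,_)
open import Relation.Nullary using (¬_; does)
open import Relation.Binary.PropositionalEquality using (_≡_)
open import Function.Bundles using (_⤖_; Bijection)

Graph : ℕ → Set
Graph n = Fin n → Fin n → Bool

Simple : ∀ {n} → Graph n → Set
Simple {n} G = (∀ (x y : Fin n) → G x y ≡ G y x) × (∀ (x : Fin n) → G x x ≡ false)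

-- Reach G X u v : there is a walk from u to v in G all of whose vertices lie in X
-- (i.e. u and v are in the same component of the induced subgraph G[X]).
data Reach {n} (G : Graph n) (X : Subset n) : Fin n → Fin n → Set where
  here : ∀ {x} → x ∈ X → Reach G X x x
  step : ∀ {x y z} → x ∈ X → G x y ≡ true → Reach G X y z → Reach G X x z

Connected : ∀ {n} → Graph n → Set
Connected {n} G = ∀ (u v : Fin n) → Reach G ⊤ u v

data Chain {n} (G : Graph n) : Fin n → List (Fin n) → Set where
  []  : ∀ {x} → Chain G x []
  _∷_ : ∀ {x y ys} → G x y ≡ true → Chain G y ys → Chain G x (y ∷ ys)

lastOf : ∀ {n} → Fin n → List (Fin n) → Fin n
lastOf x []       = x
lastOf x (y ∷ ys) = lastOf y ys

HasCycle : ∀ {n} → Graph n → Set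
HasCycle {n} G = Σ (Fin n) λ x → Σ (List (Fin n)) λ ys →
  (2 ≤ length ys) × Unique (x ∷ ys) × Chain G x ys × (G (lastOf x ys) x ≡ true)

IsTree : ∀ {n} → Graph n → Set
IsTree G = Simple G × Connected G × ¬ HasCycle G

IsCutset : ∀ {n} → Graph n → Subset n → Set
IsCutset {n} G S = Σ (Fin n) λ u → Σ (Fin n) λ v →
  u ∉ S × v ∉ S × ¬ Reach G (∁ S) u v

IsRgCutset : ∀ {n} → Graph n → ℕ → Subset n → Set
IsRgCutset {n} G g S = IsCutset G S ×
  (∀ (u : Fin n) → u ∉ S → Σ (Subset n) λ C →
     (suc g ≤ ∣ C ∣) × (∀ (v : Fin n) → v ∈ C → Reach G (∁ S) u v))

HasRgCutsetWithKappa : ∀ {n} → Graph n → ℕ → ℕ → Set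
HasRgCutsetWithKappa {n} G g k =
  (Σ (Subset n) λ S → IsRgCutset G g S × ∣ S ∣ ≡ k) ×
  (∀ (S : Subset n) → IsRgCutset G g S → k ≤ ∣ S ∣)

Iso : ∀ {m k} → Graph m → Graph k → Set
Iso {m} {k} G H = Σ (Fin m ⤖ Fin k) λ f →
  ∀ (x y : Fin m) → G x y ≡ H (Bijection.to f x) (Bijection.to f y)

-- A graph with a distinguished vertex (the one joined to the new vertex v).
record Pointed : Set where
  constructor pointed
  field
    size  : ℕ
    graph : Graph size
    root  : Fin size
open Pointed public

total : List Pointed → ℕ
total []       = 0
total (p ∷ ps) = size p + total ps

unionAdj : (ps : List Pointed) → Graph (total ps)
unionAdj [] () ()
unionAdj (p ∷ ps) x y with splitAt (size p) x | splitAt (size p) y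
... | inj₁ a | inj₁ b = graph p a b
... | inj₂ a | inj₂ b = unionAdj ps a b
... | _      | _      = false

isRoot : (ps : List Pointed) → Fin (total ps) → Bool
isRoot [] ()
isRoot (p ∷ ps) x with splitAt (size p) x
... | inj₁ a = does (a ≟ root p)
... | inj₂ a = isRoot ps a

star : (ps : List Pointed) → Graph (suc (total ps))
star ps zero    zero    = false
star ps zero    (suc y) = isRoot ps y
star ps (suc x) zero    = isRoot ps x
star ps (suc x) (suc y) = unionAdj ps x y

-- Everything turns on a vertex v such that T − v has two components A, B of order g + 1 and all
-- other components have at most g vertices; these are the centres of the star shape.  For such v the
-- complement of A ∪ B is an R_g-cutset with n − 2g − 2 vertices, and it is minimum because every
-- R_g-cutset contains v and leaves only vertices of A ∪ B.  Conversely, a minimum R_g-cutset S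
-- contains a vertex v adjacent to both sides of the cut (else S − v would be a smaller R_g-cutset).
-- The complement of a union of at least two components of T − v of order > g is an R_g-cutset, so by
-- minimality such a union has at most 2g + 2 vertices, which forces the sizes above.

module Submission where

open import Defs
open import Data.Bool using (true; false)
import Data.Bool.Properties as Bool
open import Data.Empty using (⊥-elim)
open import Data.Fin using (Fin; zero; suc; splitAt; _↑ˡ_; _↑ʳ_) renaming (_≟_ to _≟ᶠ_)
open import Data.Fin.Properties
  using (any?; injective⇒≤; cantor-schröder-bernstein; splitAt-↑ˡ; splitAt-↑ʳ; splitAt⁻¹-↑ˡ; splitAt⁻¹-↑ʳ)
  renaming (suc-injective to fsuc-injective)
open import Data.Fin.Subset
  using (Subset; inside; outside; _∈_; _∉_; _⊆_; _⊂_; ∁; ⊤; _∪_; _─_; _-_; ⁅_⁆; ∣_∣) renaming (⊥ to ∅)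
open import Data.Fin.Subset.Properties
  using ( _∈?_; ∈⊤; ∉⊥; x∈⁅x⁆; ⊆-antisym; ∣p∣≤n; ∣⊤∣≡n; ∣⊥∣≡0; p⊆q⇒∣p∣≤∣q∣; p⊂q⇒∣p∣<∣q∣; ∣∁p∣≡n∸∣p∣
        ; x∈p∪q⁺; x∈p∪q⁻; p─q⊆p; x∈p∧x≢y⇒x∈p-y; x∈p⇒∣p-x∣<∣p∣; x∈p⇒x∉∁p; x∈∁p⇒x∉p; x∉p⇒x∈∁p
        ; x∉∁p⇒x∈p; p⊆q⇒∁p⊇∁q )
open import Data.List using (List; []; _∷_; map; filter; allFin)
open import Data.List.Properties using (length-map)
open import Data.List.Membership.Propositional using () renaming (_∈_ to _∈ˡ_)
open import Data.List.Membership.Propositional.Properties using (∈-allFin; ∈-filter⁺)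
open import Data.List.Relation.Unary.All using (All; []; _∷_)
import Data.List.Relation.Unary.All as All
open import Data.List.Relation.Unary.All.Properties using (all-filter; ¬Any⇒All¬)
open import Data.List.Relation.Unary.Any using (Any; here; there)
import Data.List.Relation.Unary.Any as Any
open import Data.List.Relation.Unary.AllPairs using ([]; _∷_)
open import Data.List.Relation.Unary.Unique.Propositional using (Unique)
import Data.List.Relation.Unary.Unique.Propositional.Properties as Unique
open import Data.Nat using (ℕ; zero; suc; _+_; _*_; _∸_; _≤_; _<_; z≤n; s≤s; s≤s⁻¹; _/_)
open import Data.Nat.Properties
open import Data.Nat.Tactic.RingSolver using (solve-∀)
open import Data.Product using (Σ; ∃; ∃₂; _×_; _,_; proj₁; proj₂)
open import Data.Sum using (_⊎_; inj₁; inj₂; [_,_]′)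
open import Data.Vec using ([]; _∷_; _++_; tabulate; here; there)
open import Data.Vec.Properties using (lookup∘tabulate; []=⇒lookup; lookup⇒[]=)
open import Function using (_∘_; id)
open import Function.Bundles using (_⇔_; mk⇔; Bijection; mk⤖; Inverse)
open import Function.Definitions using (Injective)
open import Function.Properties.Bijection using (⤖⇒↔)
open import Relation.Nullary using (¬_; Dec; yes; no; does; ¬?; contradiction)
open import Relation.Nullary.Decidable using (dec-true; map′; _×-dec_)
open import Relation.Unary using (Decidable)
open import Relation.Binary.PropositionalEquality
  using (_≡_; _≢_; refl; sym; trans; cong; cong₂; subst; subst₂; module ≡-Reasoning)

private
  variable
    n m g : ℕ

[1+g]+[1+g]≡2g+2 : ∀ g → suc g + suc g ≡ 2 * g + 2
[1+g]+[1+g]≡2g+2 = solve-∀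

[1+[1+g]+[1+g]+t]∸[2g+3]≡t : ∀ g t → suc (suc g + (suc g + t)) ∸ (2 * g + 3) ≡ t
[1+[1+g]+[1+g]+t]∸[2g+3]≡t g t =
  trans (cong (_∸ (2 * g + 3)) (rearrange g t)) (m+n∸m≡n (2 * g + 3) t)
  where
  rearrange : ∀ g t → suc (suc g + (suc g + t)) ≡ 2 * g + 3 + t
  rearrange = solve-∀

m∸n≤o⇒m∸o≤n : ∀ m n o → m ∸ n ≤ o → m ∸ o ≤ n
m∸n≤o⇒m∸o≤n m n o m∸n≤o = m≤n+o⇒m∸n≤o m o
  (subst (m ≤_) (+-comm n o) (≤-trans (m≤n+m∸n m n) (+-monoʳ-≤ n m∸n≤o)))

squeeze : ∀ {g x y} → suc g ≤ x → suc g ≤ y → x + y ≤ suc g + suc g → x ≡ suc g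
squeeze {g} {x} {y} g<x g<y x+y≤ = ≤-antisym (+-cancelʳ-≤ y x (suc g) (≤-trans x+y≤ (+-monoʳ-≤ (suc g) g<y))) g<x

subsetOf : {P : Fin n → Set} → Decidable P → Subset n
subsetOf P? = tabulate (does ∘ P?)

module _ {P : Fin n → Set} (P? : Decidable P) where

  ∈-subsetOf⁺ : ∀ {x} → P x → x ∈ subsetOf P?
  ∈-subsetOf⁺ {x} px = lookup⇒[]= x _ (trans (lookup∘tabulate _ x) (dec-true (P? x) px))

  ∈-subsetOf⁻ : ∀ {x} → x ∈ subsetOf P? → P x
  ∈-subsetOf⁻ {x} x∈ with P? x | trans (sym (lookup∘tabulate (does ∘ P?) x)) ([]=⇒lookup x∈)
  ... | yes px | _ = px

x∈p─q⇒x∉q : ∀ {p q : Subset n} {x} → x ∈ p ─ q → x ∉ q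
x∈p─q⇒x∉q {p = _ ∷ _} {outside ∷ _} here        ()
x∈p─q⇒x∉q {p = _ ∷ _} {_ ∷ _}       (there x∈) (there x∈q) = x∈p─q⇒x∉q x∈ x∈q

x∈p-y⇒x≢y : ∀ {p : Subset n} {x y} → x ∈ p - y → x ≢ y
x∈p-y⇒x≢y x∈ refl = x∈p─q⇒x∉q x∈ (x∈⁅x⁆ _)

x∈p⇒∁p⊆⊤-x : ∀ {p : Subset n} {x} → x ∈ p → ∁ p ⊆ ⊤ - x
x∈p⇒∁p⊆⊤-x x∈p y∈∁p = x∈p∧x≢y⇒x∈p-y ∈⊤ λ { refl → x∈∁p⇒x∉p y∈∁p x∈p }

-- nth and rank identify Fin ∣ p ∣ with the elements of p, listed in increasing order.
nth : (p : Subset n) → Fin ∣ p ∣ → Fin n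
nth (inside  ∷ p) zero    = zero
nth (inside  ∷ p) (suc i) = suc (nth p i)
nth (outside ∷ p) i       = suc (nth p i)

nth∈ : (p : Subset n) (i : Fin ∣ p ∣) → nth p i ∈ p
nth∈ (inside  ∷ p) zero    = here
nth∈ (inside  ∷ p) (suc i) = there (nth∈ p i)
nth∈ (outside ∷ p) i       = there (nth∈ p i)

rank : ∀ {p : Subset n} {x} → x ∈ p → Fin ∣ p ∣
rank here                          = zero
rank {p = inside  ∷ _} (there x∈p) = suc (rank x∈p)
rank {p = outside ∷ _} (there x∈p) = rank x∈p

nth-rank : ∀ {p : Subset n} {x} (x∈p : x ∈ p) → nth p (rank x∈p) ≡ x
nth-rank here                          = refl
nth-rank {p = inside  ∷ _} (there x∈p) = cong suc (nth-rank x∈p)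
nth-rank {p = outside ∷ _} (there x∈p) = cong suc (nth-rank x∈p)

nth-injective : (p : Subset n) → Injective _≡_ _≡_ (nth p)
nth-injective (inside  ∷ _) {zero}  {zero}  _  = refl
nth-injective (inside  ∷ p) {suc i} {suc j} eq = cong suc (nth-injective p (fsuc-injective eq))
nth-injective (outside ∷ p)                 eq = nth-injective p (fsuc-injective eq)

0<∣p∣ : ∀ {p : Subset n} {x} → x ∈ p → 0 < ∣ p ∣
0<∣p∣ x∈p = ≤-<-trans z≤n (x∈p⇒∣p-x∣<∣p∣ x∈p)

∣p∣≤∣q∣-injection : ∀ {p : Subset n} {q : Subset m} {f : Fin n → Fin m} →
  Injective _≡_ _≡_ f → (∀ {x} → x ∈ p → f x ∈ q) → ∣ p ∣ ≤ ∣ q ∣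
∣p∣≤∣q∣-injection {p = p} {q} {f} f-injective f∈ = injective⇒≤ h-injective
  where
  h : Fin ∣ p ∣ → Fin ∣ q ∣
  h i = rank (f∈ (nth∈ p i))

  h-injective : Injective _≡_ _≡_ h
  h-injective {i} {j} hi≡hj = nth-injective p (f-injective (begin
    f (nth p i)  ≡⟨ sym (nth-rank (f∈ (nth∈ p i))) ⟩
    nth q (h i)  ≡⟨ cong (nth q) hi≡hj ⟩
    nth q (h j)  ≡⟨ nth-rank (f∈ (nth∈ p j)) ⟩
    f (nth p j)  ∎))
    where open ≡-Reasoning

∷-disjoint : ∀ {s t} {p q : Subset n} → (∀ {x} → x ∈ s ∷ p → x ∉ t ∷ q) → ∀ {x} → x ∈ p → x ∉ q
∷-disjoint disjoint x∈p x∈q = disjoint (there x∈p) (there x∈q)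

∣p∪q∣≡∣p∣+∣q∣ : ∀ {p q : Subset n} → (∀ {x} → x ∈ p → x ∉ q) → ∣ p ∪ q ∣ ≡ ∣ p ∣ + ∣ q ∣
∣p∪q∣≡∣p∣+∣q∣ {p = []}          {[]}          _        = refl
∣p∪q∣≡∣p∣+∣q∣ {p = inside  ∷ _} {inside  ∷ _} disjoint = contradiction here (disjoint here)
∣p∪q∣≡∣p∣+∣q∣ {p = inside  ∷ p} {outside ∷ q} disjoint = cong suc (∣p∪q∣≡∣p∣+∣q∣ (∷-disjoint disjoint))
∣p∪q∣≡∣p∣+∣q∣ {p = outside ∷ p} {inside  ∷ q} disjoint =
  trans (cong suc (∣p∪q∣≡∣p∣+∣q∣ (∷-disjoint disjoint))) (sym (+-suc ∣ p ∣ ∣ q ∣))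
∣p∪q∣≡∣p∣+∣q∣ {p = outside ∷ p} {outside ∷ q} disjoint = ∣p∪q∣≡∣p∣+∣q∣ (∷-disjoint disjoint)

∈-++⁺ˡ : ∀ {p : Subset m} {q : Subset n} {x} → x ∈ p → x ↑ˡ n ∈ p ++ q
∈-++⁺ˡ here        = here
∈-++⁺ˡ (there x∈p) = there (∈-++⁺ˡ x∈p)

∈-++⁺ʳ : ∀ (p : Subset m) {q : Subset n} {x} → x ∈ q → m ↑ʳ x ∈ p ++ q
∈-++⁺ʳ []      x∈q = x∈q
∈-++⁺ʳ (_ ∷ p) x∈q = there (∈-++⁺ʳ p x∈q)

∈-++⁻ˡ : ∀ {p : Subset m} {q : Subset n} {x} → x ↑ˡ n ∈ p ++ q → x ∈ p
∈-++⁻ˡ {p = _ ∷ _} {x = zero}  here    = here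
∈-++⁻ˡ {p = _ ∷ _} {x = suc _} (there x∈) = there (∈-++⁻ˡ x∈)

∈-++⁻ʳ : ∀ (p : Subset m) {q : Subset n} {x} → m ↑ʳ x ∈ p ++ q → x ∈ q
∈-++⁻ʳ []      x∈         = x∈
∈-++⁻ʳ (_ ∷ p) (there x∈) = ∈-++⁻ʳ p x∈

∣p++q∣≡∣p∣+∣q∣ : (p : Subset m) (q : Subset n) → ∣ p ++ q ∣ ≡ ∣ p ∣ + ∣ q ∣
∣p++q∣≡∣p∣+∣q∣ []            q = refl
∣p++q∣≡∣p∣+∣q∣ (inside  ∷ p) q = cong suc (∣p++q∣≡∣p∣+∣q∣ p q)
∣p++q∣≡∣p∣+∣q∣ (outside ∷ p) q = ∣p++q∣≡∣p∣+∣q∣ p q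

module _ {G : Graph n} where

  reach-src : ∀ {X u w} → Reach G X u w → u ∈ X
  reach-src (here u∈X)     = u∈X
  reach-src (step u∈X _ _) = u∈X

  reach-tgt : ∀ {X u w} → Reach G X u w → w ∈ X
  reach-tgt (here w∈X)   = w∈X
  reach-tgt (step _ _ r) = reach-tgt r

  reach-trans : ∀ {X u v w} → Reach G X u v → Reach G X v w → Reach G X u w
  reach-trans (here _)       r′ = r′
  reach-trans (step u∈X e r) r′ = step u∈X e (reach-trans r r′)

  reach-mono : ∀ {X Y u w} → X ⊆ Y → Reach G X u w → Reach G Y u w
  reach-mono X⊆Y (here u∈X)     = here (X⊆Y u∈X)
  reach-mono X⊆Y (step u∈X e r) = step (X⊆Y u∈X) e (reach-mono X⊆Y r)

  reach-restrict : ∀ {X Y u w} → (∀ {y} → Reach G X u y → y ∈ Y) → Reach G X u w → Reach G Y u w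
  reach-restrict inY (here u∈X)     = here (inY (here u∈X))
  reach-restrict inY (step u∈X e r) = step (inY (here u∈X)) e (reach-restrict (inY ∘ step u∈X e) r)

  reach-invariant : ∀ {X u w} (P : Fin n → Set) →
    (∀ {x y} → P x → G x y ≡ true → y ∈ X → P y) → P u → Reach G X u w → P w
  reach-invariant P step-P Pu (here _)     = Pu
  reach-invariant P step-P Pu (step _ e r) = reach-invariant P step-P (step-P Pu e (reach-src r)) r

  boundary-edge : ∀ {P : Fin n → Set} → Decidable P → ∀ {X u w} → P u → ¬ P w → Reach G X u w →
    ∃₂ λ x y → P x × ¬ P y × G x y ≡ true
  boundary-edge P? Pu ¬Pw (here _) = contradiction Pu ¬Pw
  boundary-edge P? {u = u} Pu ¬Pw (step {y = y} _ e r) with P? y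
  ... | yes Py = boundary-edge P? Py ¬Pw r
  ... | no ¬Py = u , y , Pu , ¬Py , e

  leaving-component : ∀ {X u a v} → Reach G X u a → G a v ≡ true → ¬ Reach G X u v → v ∉ X
  leaving-component u⇝a a~v ¬u⇝v v∈X = ¬u⇝v (reach-trans u⇝a (step (reach-tgt u⇝a) a~v (here v∈X)))

  reach-avoid : ∀ {X y w u} → Reach G X y w → w ≢ u →
    Reach G (X - u) y w ⊎ ∃ λ z → G u z ≡ true × Reach G (X - u) z w
  reach-avoid (here w∈X) w≢u = inj₁ (here (x∈p∧x≢y⇒x∈p-y w∈X w≢u))
  reach-avoid {u = u} (step {x = x} {y = y} x∈X e r) w≢u with reach-avoid r w≢u | x ≟ᶠ u
  ... | inj₂ cut  | _        = inj₂ cut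
  ... | inj₁ r′   | yes refl = inj₂ (y , e , r′)
  ... | inj₁ r′   | no x≢u   = inj₁ (step (x∈p∧x≢y⇒x∈p-y x∈X x≢u) e r′)

  reach-via-neighbour : ∀ {X u w} → Reach G X u w → u ≢ w → ∃ λ z → G u z ≡ true × Reach G (X - u) z w
  reach-via-neighbour (here _)     u≢w = contradiction refl u≢w
  reach-via-neighbour (step _ e r) u≢w = [ (λ r′ → _ , e , r′) , id ]′ (reach-avoid r (u≢w ∘ sym))

  -- Recursion on ∣ X ∣: a walk from u to w ≠ u continues from a neighbour of u inside X − u.
  reach-bounded? : ∀ k {X} → ∣ X ∣ ≤ k → ∀ u w → Dec (Reach G X u w)
  reach-via-neighbour? : ∀ k {X u w} → ∣ X ∣ ≤ k → u ∈ X → u ≢ w → Dec (Reach G X u w)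

  reach-bounded? k {X} ∣X∣≤k u w with u ∈? X | u ≟ᶠ w
  ... | no u∉X  | _        = no (u∉X ∘ reach-src)
  ... | yes u∈X | yes refl = yes (here u∈X)
  ... | yes u∈X | no u≢w   = reach-via-neighbour? k ∣X∣≤k u∈X u≢w

  reach-via-neighbour? zero ∣X∣≤0 u∈X _ = contradiction (≤-trans (0<∣p∣ u∈X) ∣X∣≤0) λ ()
  reach-via-neighbour? (suc k) {X} {u} {w} ∣X∣≤1+k u∈X u≢w =
    map′ (λ (z , e , r) → step u∈X e (reach-mono (p─q⊆p X ⁅ u ⁆) r))
         (λ r → reach-via-neighbour r u≢w)
         (any? λ z → (G u z Bool.≟ true) ×-dec reach-bounded? k ∣X-u∣≤k z w)
    where
    ∣X-u∣≤k : ∣ X - u ∣ ≤ k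
    ∣X-u∣≤k = s≤s⁻¹ (≤-trans (x∈p⇒∣p-x∣<∣p∣ u∈X) ∣X∣≤1+k)

  record Path (X : Subset n) (u w : Fin n) : Set where
    field
      vertices : List (Fin n)
      chain    : Chain G u vertices
      ends     : lastOf u vertices ≡ w
      unique   : Unique (u ∷ vertices)
      within   : All (_∈ X) (u ∷ vertices)

  path-suffix : ∀ {X s w x} (zs : List (Fin n)) → Chain G s zs → lastOf s zs ≡ w →
    Unique (s ∷ zs) → All (_∈ X) (s ∷ zs) → x ∈ˡ s ∷ zs → Path X x w
  path-suffix zs c l uq inX (here refl) = record { vertices = zs ; chain = c ; ends = l ; unique = uq ; within = inX }
  path-suffix (_ ∷ zs) (_ ∷ c) l (_ ∷ uq) (_ ∷ inX) (there x∈zs) = path-suffix zs c l uq inX x∈zs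

  path : ∀ {X u w} → Reach G X u w → Path X u w
  path (here u∈X) = record { vertices = [] ; chain = [] ; ends = refl ; unique = [] ∷ [] ; within = u∈X ∷ [] }
  path {u = u} (step {y = y} u∈X e r) with path r
  ... | record { vertices = ys ; chain = c ; ends = l ; unique = uq ; within = inX }
      with Any.any? (u ≟ᶠ_) (y ∷ ys)
  ...   | yes u∈ys = path-suffix ys c l uq inX u∈ys
  ...   | no  u∉ys = record
    { vertices = y ∷ ys ; chain = e ∷ c ; ends = l
    ; unique = ¬Any⇒All¬ (y ∷ ys) u∉ys ∷ uq ; within = u∈X ∷ inX }

reach-map : ∀ {G : Graph n} {H : Graph m} {X Y} (f : Fin n → Fin m) →
  (∀ {x} → x ∈ X → f x ∈ Y) → (∀ {x y} → G x y ≡ true → H (f x) (f y) ≡ true) →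
  ∀ {u w} → Reach G X u w → Reach H Y (f u) (f w)
reach-map f f∈ f-edge (here u∈X)     = here (f∈ u∈X)
reach-map f f∈ f-edge (step u∈X e r) = step (f∈ u∈X) (f-edge e) (reach-map f f∈ f-edge r)

module Components (G : Graph n) where

  reach? : ∀ X u w → Dec (Reach G X u w)
  reach? X = reach-bounded? n (∣p∣≤n X)

  opaque
    component : Subset n → Fin n → Subset n
    component X u = subsetOf (reach? X u)

    ∈-component⁺ : ∀ {X u w} → Reach G X u w → w ∈ component X u
    ∈-component⁺ {X} {u} = ∈-subsetOf⁺ (reach? X u)

    ∈-component⁻ : ∀ {X u w} → w ∈ component X u → Reach G X u w
    ∈-component⁻ {X} {u} = ∈-subsetOf⁻ (reach? X u)

  component-⊆ : ∀ {X u} → component X u ⊆ X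
  component-⊆ u∈ = reach-tgt (∈-component⁻ u∈)

module _ {G : Graph n} (simple : Simple G) where

  open Components G

  adj-sym : ∀ {x y} → G x y ≡ true → G y x ≡ true
  adj-sym {x} {y} e = trans (proj₁ simple y x) e

  adj-irrefl : ∀ {x y} → G x y ≡ true → x ≢ y
  adj-irrefl {x} e refl = contradiction (trans (sym e) (proj₂ simple x)) λ ()

  reach-sym : ∀ {X u w} → Reach G X u w → Reach G X w u
  reach-sym (here u∈X)     = here u∈X
  reach-sym (step u∈X e r) = reach-trans (reach-sym r) (step (reach-src r) (adj-sym e) (here u∈X))

  component-≡ : ∀ {X u w} → w ∈ component X u → component X w ≡ component X u
  component-≡ w∈ = ⊆-antisym
    (∈-component⁺ ∘ reach-trans (∈-component⁻ w∈) ∘ ∈-component⁻)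
    (∈-component⁺ ∘ reach-trans (reach-sym (∈-component⁻ w∈)) ∘ ∈-component⁻)

  component-saturated : ∀ {X u x} → x ∈ component X u → component X x ⊆ component X u
  component-saturated x∈ {y} y∈ = subst (y ∈_) (component-≡ x∈) y∈

  components-disjoint : ∀ {X u w x} → ¬ Reach G X u w → x ∈ component X u → x ∉ component X w
  components-disjoint ¬u⇝w x∈u x∈w =
    ¬u⇝w (reach-trans (∈-component⁻ x∈u) (reach-sym (∈-component⁻ x∈w)))

  component-connected : ∀ {X u x y} → x ∈ component X u → y ∈ component X u →
    Reach G (component X u) x y
  component-connected x∈ y∈ = reach-restrict
    (∈-component⁺ ∘ reach-trans (∈-component⁻ x∈))
    (reach-trans (reach-sym (∈-component⁻ x∈)) (∈-component⁻ y∈))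

  reach-from-neighbour : Connected G → ∀ {v x} → v ≢ x → ∃ λ w → G v w ≡ true × Reach G (⊤ - v) w x
  reach-from-neighbour connected {v} {x} = reach-via-neighbour (connected v x)

  neighbours-separated : ¬ HasCycle G → ∀ {v a b} → G v a ≡ true → G v b ≡ true → a ≢ b →
    ¬ Reach G (⊤ - v) a b
  neighbours-separated acyclic {v} {a} v~a v~b a≢b a⇝b with path a⇝b
  ... | record { vertices = [] ; ends = a≡b } = a≢b a≡b
  ... | record { vertices = y ∷ ys ; chain = c ; ends = l ; unique = uq ; within = a∉v } =
    acyclic (v , a ∷ y ∷ ys , s≤s (s≤s z≤n) , All.map (λ x∈ → x∈p-y⇒x≢y x∈ ∘ sym) a∉v ∷ uq ,
             v~a ∷ c , subst (λ z → G z v ≡ true) (sym l) (adj-sym v~b))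

-- R_g-cutsets and the components of G − v

record LargeComponents (G : Graph n) (g : ℕ) (v : Fin n) (U : Subset n) : Set where
  open Components G
  field
    centre∉   : v ∉ U
    saturated : ∀ {x} → x ∈ U → component (⊤ - v) x ⊆ U
    large     : ∀ {x} → x ∈ U → g < ∣ component (⊤ - v) x ∣

module _ {G : Graph n} (simple : Simple G) where

  open Components G

  ∁-RgCutset : ∀ {g v U} → LargeComponents G g v U → ∀ {a b} → a ∈ U → b ∈ U → ¬ Reach G (⊤ - v) a b →
    IsRgCutset G g (∁ U)
  ∁-RgCutset {g} {v} {U} L {a} {b} a∈ b∈ separated =
    (a , b , x∈p⇒x∉∁p a∈ , x∈p⇒x∉∁p b∈ , separated ∘ reach-mono ∁∁U⊆⊤-v) , large-components
    where
    open LargeComponents L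

    U⊆∁∁U : U ⊆ ∁ (∁ U)
    U⊆∁∁U = x∉p⇒x∈∁p ∘ x∈p⇒x∉∁p

    ∁∁U⊆⊤-v : ∁ (∁ U) ⊆ ⊤ - v
    ∁∁U⊆⊤-v = x∈p⇒∁p⊆⊤-x (x∉p⇒x∈∁p centre∉)

    large-components : ∀ u → u ∉ ∁ U → Σ (Subset n) λ C → (g < ∣ C ∣) × (∀ w → w ∈ C → Reach G (∁ (∁ U)) u w)
    large-components u u∉∁U = component (⊤ - v) u , large u∈U ,
      λ w w∈ → reach-restrict (U⊆∁∁U ∘ saturated u∈U ∘ ∈-component⁺) (∈-component⁻ w∈)
      where u∈U = x∉∁p⇒x∈p u∉∁U

  RgCutset⇒large : ∀ {S v} → v ∈ S → IsRgCutset G g S → ∀ {x} → x ∉ S → g < ∣ component (⊤ - v) x ∣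
  RgCutset⇒large v∈S (_ , components) {x} x∉S with components x x∉S
  ... | C , g<∣C∣ , C⇝ = ≤-trans g<∣C∣ (p⊆q⇒∣p∣≤∣q∣ λ {y} y∈C →
    ∈-component⁺ (reach-mono (x∈p⇒∁p⊆⊤-x v∈S) (C⇝ y y∈C)))

  -- If v ∉ S, a component of G − S that misses v sits strictly inside a component of G − v.
  centre∈RgCutset : Connected G → ∀ {v} → (∀ {x} → v ≢ x → ∣ component (⊤ - v) x ∣ ≤ suc g) →
    ∀ {S} → IsRgCutset G g S → v ∈ S
  centre∈RgCutset connected {v} bounded {S} ((u , w , u∉S , w∉S , ¬u⇝w) , components) with v ∈? S
  ... | yes v∈S = v∈S
  ... | no  v∉S = ⊥-elim (¬u⇝w (reach-trans (reaches-centre u∉S) (reach-sym simple (reaches-centre w∉S))))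
    where
    v∈∁S = x∉p⇒x∈∁p v∉S

    reaches-centre : ∀ {x} → x ∉ S → Reach G (∁ S) x v
    reaches-centre {x} x∉S with reach? (∁ S) x v | components x x∉S
    ... | yes x⇝v | _ = x⇝v
    ... | no ¬x⇝v | C , g<∣C∣ , C⇝ =
      contradiction (≤-trans g<∣C∣ (s≤s⁻¹ (<-≤-trans (p⊂q⇒∣p∣<∣q∣ C⊂Cᵥ) (bounded v≢x)))) (<-irrefl refl)
      where
      v≢x : v ≢ x
      v≢x refl = ¬x⇝v (here v∈∁S)

      avoids-v : ∀ {y} → Reach G (∁ S) x y → y ∈ ⊤ - v
      avoids-v x⇝y = x∈p∧x≢y⇒x∈p-y ∈⊤ λ { refl → ¬x⇝v x⇝y }

      missing-neighbour : (∃ λ w′ → G v w′ ≡ true × Reach G (⊤ - v) w′ x) →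
        ∃ λ y → y ∈ component (⊤ - v) x × y ∉ C
      missing-neighbour (w′ , v~w′ , w′⇝x) = w′ , ∈-component⁺ (reach-sym simple w′⇝x) ,
        λ w′∈C → ¬x⇝v (reach-trans (C⇝ w′ w′∈C) (step (reach-tgt (C⇝ w′ w′∈C)) (adj-sym simple v~w′) (here v∈∁S)))

      C⊂Cᵥ : C ⊂ component (⊤ - v) x
      C⊂Cᵥ = (λ {y} y∈C → ∈-component⁺ (reach-restrict avoids-v (C⇝ y y∈C))) ,
             missing-neighbour (reach-from-neighbour simple connected v≢x)

  RgCutset-remove : ∀ {g S} → IsRgCutset G g S → ∀ {s a u w} → u ∉ S → w ∉ S → ¬ Reach G (∁ S) u w →
    G s a ≡ true → Reach G (∁ S) u a → (∀ {b} → G s b ≡ true → ¬ Reach G (∁ S) w b) →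
    IsRgCutset G g (S - s)
  RgCutset-remove {g} {S} (_ , components) {s} {u = u} {w} u∉S w∉S ¬u⇝w s~a u⇝a ¬w⇝N[s] =
    (u , w , u∉S ∘ p─q⊆p S ⁅ s ⁆ , w∉S ∘ p─q⊆p S ⁅ s ⁆ , ¬u⇝w ∘ reach-sym simple ∘ w-side ∘ reach-sym simple) ,
    large-components
    where
    ∁S⊆∁[S-s] : ∁ S ⊆ ∁ (S - s)
    ∁S⊆∁[S-s] = p⊆q⇒∁p⊇∁q (p─q⊆p S ⁅ s ⁆)

    s∈∁[S-s] : s ∈ ∁ (S - s)
    s∈∁[S-s] = x∉p⇒x∈∁p λ s∈ → x∈p-y⇒x≢y s∈ refl

    w-side : ∀ {y} → Reach G (∁ (S - s)) w y → Reach G (∁ S) w y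
    w-side = reach-invariant (Reach G (∁ S) w) extend (here (x∉p⇒x∈∁p w∉S))
      where
      extend : ∀ {x y} → Reach G (∁ S) w x → G x y ≡ true → y ∈ ∁ (S - s) → Reach G (∁ S) w y
      extend {x} {y} w⇝x x~y y∈ with y ≟ᶠ s
      ... | yes refl = contradiction w⇝x (¬w⇝N[s] (adj-sym simple x~y))
      ... | no  y≢s  = reach-trans w⇝x (step (reach-tgt w⇝x) x~y
                         (here (x∉p⇒x∈∁p λ y∈S → x∈∁p⇒x∉p y∈ (x∈p∧x≢y⇒x∈p-y y∈S y≢s))))

    large-components : ∀ x → x ∉ S - s → Σ (Subset n) λ C → (g < ∣ C ∣) × (∀ y → y ∈ C → Reach G (∁ (S - s)) x y)
    large-components x x∉S-s with x ≟ᶠ s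
    ... | yes refl = let C , g<∣C∣ , C⇝ = components u u∉S in
      C , g<∣C∣ , λ y y∈C → step s∈∁[S-s] s~a
        (reach-mono ∁S⊆∁[S-s] (reach-trans (reach-sym simple u⇝a) (C⇝ y y∈C)))
    ... | no  x≢s  = let C , g<∣C∣ , C⇝ = components x (λ x∈S → x∉S-s (x∈p∧x≢y⇒x∈p-y x∈S x≢s)) in
      C , g<∣C∣ , λ y y∈C → reach-mono ∁S⊆∁[S-s] (C⇝ y y∈C)

  LargeComponents-bound : ∀ {g v U} → (∀ S → IsRgCutset G g S → n ∸ (2 * g + 2) ≤ ∣ S ∣) →
    LargeComponents G g v U → ∀ {a b} → a ∈ U → b ∈ U → ¬ Reach G (⊤ - v) a b → ∣ U ∣ ≤ 2 * g + 2
  LargeComponents-bound {g} {U = U} minimal L a∈ b∈ separated = ∸-cancelʳ-≤ (∣p∣≤n U)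
    (subst (n ∸ (2 * g + 2) ≤_) (∣∁p∣≡n∸∣p∣ U) (minimal (∁ U) (∁-RgCutset L a∈ b∈ separated)))

  component-LargeComponents : ∀ {g v x} → g < ∣ component (⊤ - v) x ∣ → LargeComponents G g v (component (⊤ - v) x)
  component-LargeComponents {g} {v} {x} g<∣C∣ = record
    { centre∉   = λ v∈ → x∈p-y⇒x≢y (component-⊆ v∈) refl
    ; saturated = component-saturated simple
    ; large     = λ y∈ → subst (λ C → g < ∣ C ∣) (sym (component-≡ simple y∈)) g<∣C∣
    }

  ∪-LargeComponents : ∀ {g v U W} → LargeComponents G g v U → LargeComponents G g v W →
    LargeComponents G g v (U ∪ W)
  ∪-LargeComponents {U = U} {W} L M = record
    { centre∉   = [ L.centre∉ , M.centre∉ ]′ ∘ x∈p∪q⁻ U W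
    ; saturated = λ x∈ → [ (λ x∈U → x∈p∪q⁺ ∘ inj₁ ∘ L.saturated x∈U) ,
                           (λ x∈W → x∈p∪q⁺ ∘ inj₂ ∘ M.saturated x∈W) ]′ (x∈p∪q⁻ U W x∈)
    ; large     = [ L.large , M.large ]′ ∘ x∈p∪q⁻ U W
    }
    where
    module L = LargeComponents L
    module M = LargeComponents M

record Centre (G : Graph n) (g : ℕ) : Set where
  open Components G
  field
    centre left right : Fin n
    centre~left  : G centre left ≡ true
    centre~right : G centre right ≡ true
    separated    : ¬ Reach G (⊤ - centre) left right
    ∣left∣       : ∣ component (⊤ - centre) left ∣ ≡ suc g
    ∣right∣      : ∣ component (⊤ - centre) right ∣ ≡ suc g
    small        : ∀ {x} → centre ≢ x → x ∉ component (⊤ - centre) left →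
                   x ∉ component (⊤ - centre) right → ∣ component (⊤ - centre) x ∣ ≤ g

module _ {G : Graph n} (simple : Simple G) where

  open Components G

  ∈-own-component : ∀ {v x} → G v x ≡ true → x ∈ component (⊤ - v) x
  ∈-own-component v~x = ∈-component⁺ (here (x∈p∧x≢y⇒x∈p-y ∈⊤ (adj-irrefl simple v~x ∘ sym)))

  centre⇒kappa : Connected G → Centre G g → HasRgCutsetWithKappa G g (n ∸ (2 * g + 2))
  centre⇒kappa {g} connected c =
    (∁ (A ∪ B) , ∁-RgCutset simple A∪B-large (x∈p∪q⁺ (inj₁ (∈-own-component centre~left)))
                   (x∈p∪q⁺ (inj₂ (∈-own-component centre~right))) separated , ∣∁[A∪B]∣) ,
    minimal
    where
    open Centre c
    A = component (⊤ - centre) left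
    B = component (⊤ - centre) right

    A∪B-large : LargeComponents G g centre (A ∪ B)
    A∪B-large = ∪-LargeComponents simple (component-LargeComponents simple (≤-reflexive (sym ∣left∣)))
                                         (component-LargeComponents simple (≤-reflexive (sym ∣right∣)))

    ∣A∪B∣ : ∣ A ∪ B ∣ ≡ 2 * g + 2
    ∣A∪B∣ = trans (∣p∪q∣≡∣p∣+∣q∣ (components-disjoint simple separated))
                  (trans (cong₂ _+_ ∣left∣ ∣right∣) ([1+g]+[1+g]≡2g+2 g))

    ∣∁[A∪B]∣ : ∣ ∁ (A ∪ B) ∣ ≡ n ∸ (2 * g + 2)
    ∣∁[A∪B]∣ = trans (∣∁p∣≡n∸∣p∣ (A ∪ B)) (cong (n ∸_) ∣A∪B∣)

    component≤1+g : ∀ {x} → centre ≢ x → ∣ component (⊤ - centre) x ∣ ≤ suc g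
    component≤1+g {x} centre≢x with x ∈? A | x ∈? B
    ... | yes x∈A | _       = ≤-reflexive (trans (cong ∣_∣ (component-≡ simple x∈A)) ∣left∣)
    ... | no  _   | yes x∈B = ≤-reflexive (trans (cong ∣_∣ (component-≡ simple x∈B)) ∣right∣)
    ... | no  x∉A | no  x∉B = m≤n⇒m≤1+n (small centre≢x x∉A x∉B)

    -- An R_g-cutset contains the centre, so the vertices it leaves lie in components of order > g.
    ∁RgCutset⊆A∪B : ∀ {S} → IsRgCutset G g S → ∁ S ⊆ A ∪ B
    ∁RgCutset⊆A∪B {S} cut {x} x∈∁S with x ∈? A | x ∈? B
    ... | yes x∈A | _       = x∈p∪q⁺ (inj₁ x∈A)
    ... | no  _   | yes x∈B = x∈p∪q⁺ (inj₂ x∈B)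
    ... | no  x∉A | no  x∉B = contradiction (small centre≢x x∉A x∉B) (<⇒≱ (RgCutset⇒large simple centre∈S cut x∉S))
      where
      centre∈S = centre∈RgCutset simple connected component≤1+g cut
      x∉S = x∈∁p⇒x∉p x∈∁S
      centre≢x : centre ≢ x
      centre≢x refl = x∉S centre∈S

    minimal : ∀ S → IsRgCutset G g S → n ∸ (2 * g + 2) ≤ ∣ S ∣
    minimal S cut = m∸n≤o⇒m∸o≤n n ∣ S ∣ (2 * g + 2)
      (subst₂ _≤_ (∣∁p∣≡n∸∣p∣ S) ∣A∪B∣ (p⊆q⇒∣p∣≤∣q∣ (∁RgCutset⊆A∪B cut)))

module _ {T : Graph n} (simple : Simple T) (acyclic : ¬ HasCycle T) {g : ℕ}
         (minimal : ∀ S → IsRgCutset T g S → n ∸ (2 * g + 2) ≤ ∣ S ∣) where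

  open Components T

  -- A third large component could be added to the union, whose complement would then be an
  -- R_g-cutset below the minimum.
  large-neighbours⇒centre : ∀ {v a b} → T v a ≡ true → T v b ≡ true → a ≢ b →
    g < ∣ component (⊤ - v) a ∣ → g < ∣ component (⊤ - v) b ∣ → Centre T g
  large-neighbours⇒centre {v} {a} {b} v~a v~b a≢b g<∣A∣ g<∣B∣ = record
    { centre = v ; left = a ; right = b ; centre~left = v~a ; centre~right = v~b
    ; separated = separated ; ∣left∣ = ∣A∣≡1+g ; ∣right∣ = ∣B∣≡1+g ; small = small }
    where
    A = component (⊤ - v) a
    B = component (⊤ - v) b
    separated = neighbours-separated simple acyclic v~a v~b a≢b

    A∪B-large : LargeComponents T g v (A ∪ B)
    A∪B-large = ∪-LargeComponents simple (component-LargeComponents simple g<∣A∣)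
                                         (component-LargeComponents simple g<∣B∣)

    a∈A∪B = x∈p∪q⁺ (inj₁ (∈-own-component simple v~a))
    b∈A∪B = x∈p∪q⁺ (inj₂ (∈-own-component simple v~b))

    ∣A∪B∣≡∣A∣+∣B∣ : ∣ A ∪ B ∣ ≡ ∣ A ∣ + ∣ B ∣
    ∣A∪B∣≡∣A∣+∣B∣ = ∣p∪q∣≡∣p∣+∣q∣ (components-disjoint simple separated)

    ∣A∣+∣B∣≤ : ∣ A ∣ + ∣ B ∣ ≤ suc g + suc g
    ∣A∣+∣B∣≤ = subst₂ _≤_ ∣A∪B∣≡∣A∣+∣B∣ (sym ([1+g]+[1+g]≡2g+2 g))
      (LargeComponents-bound simple minimal A∪B-large a∈A∪B b∈A∪B separated)

    ∣A∣≡1+g = squeeze g<∣A∣ g<∣B∣ ∣A∣+∣B∣≤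
    ∣B∣≡1+g = squeeze g<∣B∣ g<∣A∣ (subst (_≤ suc g + suc g) (+-comm ∣ A ∣ ∣ B ∣) ∣A∣+∣B∣≤)

    small : ∀ {x} → v ≢ x → x ∉ A → x ∉ B → ∣ component (⊤ - v) x ∣ ≤ g
    small {x} v≢x x∉A x∉B with ∣ component (⊤ - v) x ∣ ≤? g
    ... | yes ∣C∣≤g = ∣C∣≤g
    ... | no  ∣C∣≰g = contradiction ∣C∣≤0 (<⇒≱ (≤-<-trans z≤n g<∣C∣))
      where
      C = component (⊤ - v) x
      g<∣C∣ = ≰⇒> ∣C∣≰g

      A∪B∩C-empty : ∀ {y} → y ∈ A ∪ B → y ∉ C
      A∪B∩C-empty y∈ = [ components-disjoint simple (x∉A ∘ ∈-component⁺) ,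
                         components-disjoint simple (x∉B ∘ ∈-component⁺) ]′ (x∈p∪q⁻ A B y∈)

      ∣A∪B∪C∣≤ : ∣ A ∪ B ∣ + ∣ C ∣ ≤ ∣ A ∪ B ∣ + 0
      ∣A∪B∪C∣≤ = subst₂ _≤_ (∣p∪q∣≡∣p∣+∣q∣ A∪B∩C-empty)
        (sym (trans (+-identityʳ _) (trans ∣A∪B∣≡∣A∣+∣B∣
          (trans (cong₂ _+_ ∣A∣≡1+g ∣B∣≡1+g) ([1+g]+[1+g]≡2g+2 g)))))
        (LargeComponents-bound simple minimal
          (∪-LargeComponents simple A∪B-large (component-LargeComponents simple g<∣C∣))
          (x∈p∪q⁺ (inj₁ a∈A∪B)) (x∈p∪q⁺ (inj₁ b∈A∪B)) separated)

      ∣C∣≤0 : ∣ C ∣ ≤ 0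
      ∣C∣≤0 = +-cancelˡ-≤ ∣ A ∪ B ∣ ∣ C ∣ 0 ∣A∪B∪C∣≤

-- On a path from u to w the first vertex v off the side of u lies in S; by minimality v also sees
-- the side of w.
kappa⇒centre : ∀ {T : Graph n} → IsTree T → HasRgCutsetWithKappa T g (n ∸ (2 * g + 2)) → Centre T g
kappa⇒centre {T = T} (simple , connected , acyclic)
                  ((S , cut@((u , w , u∉S , w∉S , ¬u⇝w) , _) , ∣S∣≡k) , minimal)
  with boundary-edge (Components.reach? T (∁ S) u) (here (x∉p⇒x∈∁p u∉S)) ¬u⇝w (connected u w)
... | a , v , u⇝a , ¬u⇝v , a~v
  with any? (λ b → (T v b Bool.≟ true) ×-dec Components.reach? T (∁ S) w b)
... | yes (b , v~b , w⇝b) =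
  large-neighbours⇒centre simple acyclic minimal v~a v~b a≢b
    (RgCutset⇒large simple v∈S cut (x∈∁p⇒x∉p (reach-tgt u⇝a)))
    (RgCutset⇒large simple v∈S cut (x∈∁p⇒x∉p (reach-tgt w⇝b)))
  where
  v~a = adj-sym simple a~v
  v∈S = x∉∁p⇒x∈p (leaving-component u⇝a a~v ¬u⇝v)
  a≢b : a ≢ b
  a≢b refl = ¬u⇝w (reach-trans u⇝a (reach-sym simple w⇝b))
... | no ¬w⇝N[v] =
  ⊥-elim (<-irrefl refl (≤-<-trans (minimal (S - v) S-v-cut) (subst (∣ S - v ∣ <_) ∣S∣≡k (x∈p⇒∣p-x∣<∣p∣ v∈S))))
  where
  v∈S = x∉∁p⇒x∈p (leaving-component u⇝a a~v ¬u⇝v)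
  S-v-cut = RgCutset-remove simple cut u∉S w∉S ¬u⇝w (adj-sym simple a~v) u⇝a (λ v~b w⇝b → ¬w⇝N[v] (_ , v~b , w⇝b))

module _ {G : Graph n} {H : Graph m} (iso : Iso G H) where

  private
    open Inverse (⤖⇒↔ (proj₁ iso)) using (to; from; strictlyInverseˡ; strictlyInverseʳ)

    preserves : ∀ x y → G x y ≡ H (to x) (to y)
    preserves = proj₂ iso

    reflects : ∀ a b → H a b ≡ G (from a) (from b)
    reflects a b = sym (trans (preserves (from a) (from b)) (cong₂ H (strictlyInverseˡ a) (strictlyInverseˡ b)))

    to-injective : Injective _≡_ _≡_ to
    to-injective = Bijection.injective (proj₁ iso)

    from-injective : Injective _≡_ _≡_ from
    from-injective {a} {b} eq = trans (sym (strictlyInverseˡ a)) (trans (cong to eq) (strictlyInverseˡ b))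

    pull : Subset m → Subset n
    pull S = subsetOf (λ x → to x ∈? S)

    ∈-pull⁺ : ∀ {S x} → to x ∈ S → x ∈ pull S
    ∈-pull⁺ {S} = ∈-subsetOf⁺ (λ x → to x ∈? S)

    ∈-pull⁻ : ∀ {S x} → x ∈ pull S → to x ∈ S
    ∈-pull⁻ {S} = ∈-subsetOf⁻ (λ x → to x ∈? S)

    ∉-pull⁺ : ∀ {S x} → to x ∉ S → x ∉ pull S
    ∉-pull⁺ to-x∉S = to-x∉S ∘ ∈-pull⁻

    ∣pull∣ : ∀ S → ∣ pull S ∣ ≡ ∣ S ∣
    ∣pull∣ S = ≤-antisym (∣p∣≤∣q∣-injection to-injective ∈-pull⁻)
      (∣p∣≤∣q∣-injection from-injective λ {a} a∈S → ∈-pull⁺ (subst (_∈ S) (sym (strictlyInverseˡ a)) a∈S))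

    reach-to : ∀ {S x y} → Reach G (∁ (pull S)) x y → Reach H (∁ S) (to x) (to y)
    reach-to = reach-map to (λ x∈ → x∉p⇒x∈∁p (x∈∁p⇒x∉p x∈ ∘ ∈-pull⁺)) (λ {x} {y} e → trans (sym (preserves x y)) e)

    reach-from : ∀ {S a b} → Reach H (∁ S) a b → Reach G (∁ (pull S)) (from a) (from b)
    reach-from {S} = reach-map from
      (λ {a} a∈ → x∉p⇒x∈∁p (∉-pull⁺ (subst (_∉ S) (sym (strictlyInverseˡ a)) (x∈∁p⇒x∉p a∈))))
      (λ {a} {b} e → trans (sym (reflects a b)) e)

    pull-RgCutset : ∀ {S} → IsRgCutset H g S → IsRgCutset G g (pull S)
    pull-RgCutset {g} {S} ((u , w , u∉S , w∉S , ¬u⇝w) , components) =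
      (from u , from w , ∉-pull⁺ (subst (_∉ S) (sym (strictlyInverseˡ u)) u∉S) ,
                         ∉-pull⁺ (subst (_∉ S) (sym (strictlyInverseˡ w)) w∉S) ,
       ¬u⇝w ∘ subst₂ (Reach H (∁ S)) (strictlyInverseˡ u) (strictlyInverseˡ w) ∘ reach-to) ,
      large-components
      where
      large-components : ∀ x → x ∉ pull S →
        Σ (Subset n) λ C → (g < ∣ C ∣) × (∀ y → y ∈ C → Reach G (∁ (pull S)) x y)
      large-components x x∉ = let C , g<∣C∣ , C⇝ = components (to x) (x∉ ∘ ∈-pull⁺) in
        pull C , subst (g <_) (sym (∣pull∣ C)) g<∣C∣ ,
        λ y y∈ → subst₂ (Reach G (∁ (pull S))) (strictlyInverseʳ x) (strictlyInverseʳ y)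
                   (reach-from (C⇝ (to y) (∈-pull⁻ y∈)))

  Iso-sym : Iso H G
  Iso-sym = mk⤖ {to = from} (from-injective , λ x → to x , λ { refl → strictlyInverseʳ x }) , reflects

  Iso⇒≡ : n ≡ m
  Iso⇒≡ = cantor-schröder-bernstein to-injective from-injective

  Iso-Simple : Simple G → Simple H
  Iso-Simple (symmetric , irreflexive) =
    (λ a b → trans (reflects a b) (trans (symmetric (from a) (from b)) (sym (reflects b a)))) ,
    (λ a → trans (reflects a a) (irreflexive (from a)))

  Iso-Connected : Connected G → Connected H
  Iso-Connected connected a b = subst₂ (Reach H ⊤) (strictlyInverseˡ a) (strictlyInverseˡ b)
    (reach-map to (λ _ → ∈⊤) (λ {x} {y} e → trans (sym (preserves x y)) e) (connected (from a) (from b)))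

  Iso-RgCutset : ∀ {g S} → IsRgCutset H g S → Σ (Subset n) λ S′ → IsRgCutset G g S′ × ∣ S′ ∣ ≡ ∣ S ∣
  Iso-RgCutset {S = S} cut = pull S , pull-RgCutset cut , ∣pull∣ S

Iso-kappa : ∀ {G : Graph n} {H : Graph m} {k} → Iso G H → HasRgCutsetWithKappa H g k → HasRgCutsetWithKappa G g k
Iso-kappa {k = k} iso ((S , cut , ∣S∣≡k) , minimal) =
  (let S′ , cut′ , ∣S′∣≡∣S∣ = Iso-RgCutset iso cut in S′ , cut′ , trans ∣S′∣≡∣S∣ ∣S∣≡k) ,
  λ R cutR → let R′ , cutR′ , ∣R′∣≡∣R∣ = Iso-RgCutset (Iso-sym iso) cutR in
             subst (k ≤_) ∣R′∣≡∣R∣ (minimal R′ cutR′)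

induced : Graph n → (C : Subset n) → Graph ∣ C ∣
induced G C i j = G (nth C i) (nth C j)

lastOf-map : ∀ (f : Fin n → Fin m) x ys → f (lastOf x ys) ≡ lastOf (f x) (map f ys)
lastOf-map f x []       = refl
lastOf-map f x (y ∷ ys) = lastOf-map f y ys

module _ {G : Graph n} {C : Subset n} where

  reach-induced : ∀ {x y} → Reach G C x y → ∀ {i j} → nth C i ≡ x → nth C j ≡ y → Reach (induced G C) ⊤ i j
  reach-induced (here _) i↦x j↦x =
    subst (Reach (induced G C) ⊤ _) (nth-injective C (trans i↦x (sym j↦x))) (here ∈⊤)
  reach-induced (step _ e r) i↦x j↦y =
    step ∈⊤ (trans (cong₂ G i↦x (nth-rank (reach-src r))) e) (reach-induced r (nth-rank (reach-src r)) j↦y)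

  chain-induced : ∀ {i is} → Chain (induced G C) i is → Chain G (nth C i) (map (nth C) is)
  chain-induced []      = []
  chain-induced (e ∷ c) = e ∷ chain-induced c

  induced-tree : Simple G → ¬ HasCycle G → (∀ {x y} → x ∈ C → y ∈ C → Reach G C x y) → IsTree (induced G C)
  induced-tree (symmetric , irreflexive) acyclic C-connected =
    ((λ i j → symmetric (nth C i) (nth C j)) , (λ i → irreflexive (nth C i))) ,
    (λ i j → reach-induced (C-connected (nth∈ C i) (nth∈ C j)) refl refl) ,
    λ (i , is , 2≤∣is∣ , unique , chain , closing) →
      acyclic (nth C i , map (nth C) is , subst (2 ≤_) (sym (length-map (nth C) is)) 2≤∣is∣ ,
               Unique.map⁺ (nth-injective C) unique , chain-induced chain ,
               subst (λ z → G z (nth C i) ≡ true) (lastOf-map (nth C) i is) closing)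

-- A tree is the star of its branches at any vertex

module Branches {T : Graph n} (tree : IsTree T) (v : Fin n) where

  open Components T
  private
    simple    = proj₁ tree
    connected = proj₁ (proj₂ tree)
    acyclic   = proj₂ (proj₂ tree)

  C : Fin n → Subset n
  C w = component (⊤ - v) w

  branch : ∀ {w} → T v w ≡ true → Pointed
  branch {w} v~w = pointed ∣ C w ∣ (induced T (C w)) (rank (∈-own-component simple v~w))

  branch-tree : ∀ {w} (v~w : T v w ≡ true) → IsTree (graph (branch v~w))
  branch-tree v~w = induced-tree simple acyclic (component-connected simple)

  branches : ∀ {ws} → All (λ w → T v w ≡ true) ws → List Pointed
  branches []           = []
  branches (v~w ∷ v~ws) = branch v~w ∷ branches v~ws

  All-branches : ∀ {ws} {P : Fin n → Set} {Q : Pointed → Set} →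
    (∀ {w} (v~w : T v w ≡ true) → P w → Q (branch v~w)) →
    (v~ws : All (λ w → T v w ≡ true) ws) → All P ws → All Q (branches v~ws)
  All-branches f []           []         = []
  All-branches f (v~w ∷ v~ws) (pw ∷ pws) = f v~w pw ∷ All-branches f v~ws pws

  embed : ∀ {ws} (v~ws : All (λ w → T v w ≡ true) ws) → Fin (total (branches v~ws)) → Fin n
  embed (_∷_ {x = w} v~w v~ws) x with splitAt ∣ C w ∣ x
  ... | inj₁ i = nth (C w) i
  ... | inj₂ j = embed v~ws j

  embed-↑ˡ : ∀ {w ws} (v~w : T v w ≡ true) (v~ws : All (λ w → T v w ≡ true) ws) i →
    embed (v~w ∷ v~ws) (i ↑ˡ total (branches v~ws)) ≡ nth (C w) i
  embed-↑ˡ {w} _ v~ws i rewrite splitAt-↑ˡ ∣ C w ∣ i (total (branches v~ws)) = refl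

  embed-↑ʳ : ∀ {w ws} (v~w : T v w ≡ true) (v~ws : All (λ w → T v w ≡ true) ws) j →
    embed (v~w ∷ v~ws) (∣ C w ∣ ↑ʳ j) ≡ embed v~ws j
  embed-↑ʳ {w} _ v~ws j rewrite splitAt-↑ʳ ∣ C w ∣ (total (branches v~ws)) j = refl

  embed-∈ : ∀ {ws} (v~ws : All (λ w → T v w ≡ true) ws) x → Any (λ w → embed v~ws x ∈ C w) ws
  embed-∈ (_∷_ {x = w} v~w v~ws) x with splitAt ∣ C w ∣ x
  ... | inj₁ i = here (nth∈ (C w) i)
  ... | inj₂ j = there (embed-∈ v~ws j)

  centre≢embed : ∀ {ws} (v~ws : All (λ w → T v w ≡ true) ws) x → v ≢ embed v~ws x
  centre≢embed v~ws x v≡ = x∈p-y⇒x≢y (component-⊆ (proj₂ (Any.satisfied (embed-∈ v~ws x)))) (sym v≡)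

  other-branch : ∀ {w ws} → All (w ≢_) ws → (v~ws : All (λ w → T v w ≡ true) ws) → ∀ x →
    ∃ λ w′ → (w ≢ w′ × T v w′ ≡ true) × embed v~ws x ∈ C w′
  other-branch w∉ws v~ws x = _ , All.lookupAny (All.zip (w∉ws , v~ws)) (embed-∈ v~ws x)

  branches-disjoint : ∀ {w w′ z} → T v w ≡ true → T v w′ ≡ true → w ≢ w′ → z ∈ C w → z ∉ C w′
  branches-disjoint v~w v~w′ w≢w′ = components-disjoint simple (neighbours-separated simple acyclic v~w v~w′ w≢w′)

  no-edge-between-branches : ∀ {w w′ x y} → T v w ≡ true → T v w′ ≡ true → w ≢ w′ →
    x ∈ C w → y ∈ C w′ → T x y ≡ false
  no-edge-between-branches v~w v~w′ w≢w′ x∈ y∈ = Bool.¬-not λ x~y →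
    branches-disjoint v~w v~w′ w≢w′
      (∈-component⁺ (reach-trans (∈-component⁻ x∈) (step (component-⊆ x∈) x~y (here (component-⊆ y∈))))) y∈

  root-unique : ∀ {w x} → T v w ≡ true → x ∈ C w → T v x ≡ true → x ≡ w
  root-unique {w} {x} v~w x∈ v~x with x ≟ᶠ w
  ... | yes x≡w = x≡w
  ... | no  x≢w = contradiction (∈-component⁻ x∈) (neighbours-separated simple acyclic v~w v~x (x≢w ∘ sym))

  first≢later : ∀ {w ws} → All (w ≢_) ws → T v w ≡ true → (v~ws : All (λ w → T v w ≡ true) ws) →
    ∀ i j → nth (C w) i ≢ embed v~ws j
  first≢later {w} w∉ws v~w v~ws i j eq = let w′ , (w≢w′ , v~w′) , j∈ = other-branch w∉ws v~ws j in
    branches-disjoint v~w v~w′ w≢w′ (nth∈ (C w) i) (subst (_∈ C w′) (sym eq) j∈)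

  embed-injective : ∀ {ws} → Unique ws → (v~ws : All (λ w → T v w ≡ true) ws) → Injective _≡_ _≡_ (embed v~ws)
  embed-injective (w∉ws ∷ unique) (_∷_ {x = w} v~w v~ws) {x} {y} eq
    with splitAt ∣ C w ∣ x in x↦ | splitAt ∣ C w ∣ y in y↦
  ... | inj₁ i | inj₁ j =
    trans (sym (splitAt⁻¹-↑ˡ x↦)) (trans (cong (_↑ˡ _) (nth-injective (C w) eq)) (splitAt⁻¹-↑ˡ y↦))
  ... | inj₂ i | inj₂ j =
    trans (sym (splitAt⁻¹-↑ʳ x↦)) (trans (cong (_ ↑ʳ_) (embed-injective unique v~ws eq)) (splitAt⁻¹-↑ʳ y↦))
  ... | inj₁ i | inj₂ j = contradiction eq (first≢later w∉ws v~w v~ws i j)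
  ... | inj₂ i | inj₁ j = contradiction (sym eq) (first≢later w∉ws v~w v~ws j i)

  embed-adjacency : ∀ {ws} → Unique ws → (v~ws : All (λ w → T v w ≡ true) ws) →
    ∀ x y → unionAdj (branches v~ws) x y ≡ T (embed v~ws x) (embed v~ws y)
  embed-adjacency (w∉ws ∷ unique) (_∷_ {x = w} v~w v~ws) x y with splitAt ∣ C w ∣ x | splitAt ∣ C w ∣ y
  ... | inj₁ i | inj₁ j = refl
  ... | inj₂ i | inj₂ j = embed-adjacency unique v~ws i j
  ... | inj₁ i | inj₂ j = let w′ , (w≢w′ , v~w′) , j∈ = other-branch w∉ws v~ws j in
    sym (no-edge-between-branches v~w v~w′ w≢w′ (nth∈ (C w) i) j∈)
  ... | inj₂ i | inj₁ j = let w′ , (w≢w′ , v~w′) , i∈ = other-branch w∉ws v~ws i in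
    sym (no-edge-between-branches v~w′ v~w (w≢w′ ∘ sym) i∈ (nth∈ (C w) j))

  embed-root : ∀ {ws} (v~ws : All (λ w → T v w ≡ true) ws) x → isRoot (branches v~ws) x ≡ T v (embed v~ws x)
  embed-root (_∷_ {x = w} v~w v~ws) x with splitAt ∣ C w ∣ x
  ... | inj₂ j = embed-root v~ws j
  ... | inj₁ i with i ≟ᶠ rank (∈-own-component simple v~w)
  ...   | yes refl = sym (trans (cong (T v) (nth-rank (∈-own-component simple v~w))) v~w)
  ...   | no  i≢r  = sym (Bool.¬-not λ v~x → i≢r (nth-injective (C w)
                       (trans (root-unique v~w (nth∈ (C w) i) v~x) (sym (nth-rank (∈-own-component simple v~w))))))

  embed-surjective : ∀ {ws} (v~ws : All (λ w → T v w ≡ true) ws) {w z} → w ∈ˡ ws → z ∈ C w →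
    ∃ λ x → embed v~ws x ≡ z
  embed-surjective (v~w ∷ v~ws) (here refl) z∈ = rank z∈ ↑ˡ _ , trans (embed-↑ˡ v~w v~ws _) (nth-rank z∈)
  embed-surjective (v~w ∷ v~ws) (there w∈) z∈ =
    let x , x↦z = embed-surjective v~ws w∈ z∈ in _ ↑ʳ x , trans (embed-↑ʳ v~w v~ws x) x↦z

  star-iso : ∀ {ws} → Unique ws → (∀ {z} → T v z ≡ true → z ∈ˡ ws) → (v~ws : All (λ w → T v w ≡ true) ws) →
    Iso T (star (branches v~ws))
  star-iso unique complete v~ws = Iso-sym star≅T
    where
    F : Fin (suc (total (branches v~ws))) → Fin n
    F zero    = v
    F (suc x) = embed v~ws x

    F-adjacency : ∀ x y → star (branches v~ws) x y ≡ T (F x) (F y)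
    F-adjacency zero    zero    = sym (proj₂ simple v)
    F-adjacency zero    (suc y) = embed-root v~ws y
    F-adjacency (suc x) zero    = trans (embed-root v~ws x) (proj₁ simple v (embed v~ws x))
    F-adjacency (suc x) (suc y) = embed-adjacency unique v~ws x y

    F-injective : Injective _≡_ _≡_ F
    F-injective {zero}  {zero}  _  = refl
    F-injective {zero}  {suc y} eq = contradiction eq (centre≢embed v~ws y)
    F-injective {suc x} {zero}  eq = contradiction (sym eq) (centre≢embed v~ws x)
    F-injective {suc x} {suc y} eq = cong suc (embed-injective unique v~ws eq)

    F-surjective : ∀ z → ∃ λ x → F x ≡ z
    F-surjective z with v ≟ᶠ z
    ... | yes refl = zero , refl
    ... | no  v≢z  = let w , v~w , w⇝z = reach-from-neighbour simple connected v≢z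
                         x , x↦z = embed-surjective v~ws (complete v~w) (∈-component⁺ w⇝z) in
                     suc x , x↦z

    star≅T : Iso (star (branches v~ws)) T
    star≅T = mk⤖ {to = F} (F-injective , λ z → proj₁ (F-surjective z) , λ { refl → proj₂ (F-surjective z) }) ,
             F-adjacency

StarDecomposition : ℕ → Graph n → Set
StarDecomposition {n} g T = Σ Pointed λ T′ → Σ Pointed λ T″ → Σ (List Pointed) λ Ts →
  (size T′ ≡ suc g) × IsTree (graph T′) ×
  (size T″ ≡ suc g) × IsTree (graph T″) ×
  All (λ Ti → (1 ≤ size Ti) × (size Ti ≤ g) × IsTree (graph Ti)) Ts ×
  (total Ts ≡ n ∸ (2 * g + 3)) ×
  Iso T (star (T′ ∷ T″ ∷ Ts))

centre⇒decomposition : ∀ {T : Graph n} → IsTree T → Centre T g → StarDecomposition g T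
centre⇒decomposition {n} {g} {T} tree c =
  branch centre~left , branch centre~right , branches v~others ,
  ∣left∣ , branch-tree centre~left , ∣right∣ , branch-tree centre~right ,
  All-branches small-branch v~others others-all ,
  trans (sym ([1+[1+g]+[1+g]+t]∸[2g+3]≡t g _)) (cong (_∸ (2 * g + 3)) (sym order)) ,
  iso
  where
  open Centre c
  open Branches tree centre
  simple = proj₁ tree

  Other : Fin n → Set
  Other z = T centre z ≡ true × left ≢ z × right ≢ z

  other? : Decidable Other
  other? z = (T centre z Bool.≟ true) ×-dec ¬? (left ≟ᶠ z) ×-dec ¬? (right ≟ᶠ z)

  others = filter other? (allFin n)
  others-all = all-filter other? (allFin n)
  v~others = All.map proj₁ others-all

  left≢right : left ≢ right
  left≢right refl = separated (here (x∈p∧x≢y⇒x∈p-y ∈⊤ (adj-irrefl simple centre~left ∘ sym)))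

  unique : Unique (left ∷ right ∷ others)
  unique = (left≢right ∷ All.map (proj₁ ∘ proj₂) others-all) ∷ All.map (proj₂ ∘ proj₂) others-all ∷
           Unique.filter⁺ other? (Unique.allFin⁺ n)

  complete : ∀ {z} → T centre z ≡ true → z ∈ˡ left ∷ right ∷ others
  complete {z} v~z with left ≟ᶠ z | right ≟ᶠ z
  ... | yes refl | _        = here refl
  ... | no  _    | yes refl = there (here refl)
  ... | no  l≢z  | no  r≢z  = there (there (∈-filter⁺ other? (∈-allFin z) (v~z , l≢z , r≢z)))

  iso : Iso T (star (branches (centre~left ∷ centre~right ∷ v~others)))
  iso = star-iso unique complete (centre~left ∷ centre~right ∷ v~others)

  order : n ≡ suc (suc g + (suc g + total (branches v~others)))
  order = trans (Iso⇒≡ {H = star (branches (centre~left ∷ centre~right ∷ v~others))} iso)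
                (cong suc (cong₂ (λ a b → a + (b + total (branches v~others))) ∣left∣ ∣right∣))

  small-branch : ∀ {w} (v~w : T centre w ≡ true) → Other w →
    (1 ≤ size (branch v~w)) × (size (branch v~w) ≤ g) × IsTree (graph (branch v~w))
  small-branch v~w (_ , l≢w , r≢w) =
    0<∣p∣ own , small (adj-irrefl simple v~w) (λ w∈ → branches-disjoint centre~left v~w l≢w w∈ own)
                                              (λ w∈ → branches-disjoint centre~right v~w r≢w w∈ own) ,
    branch-tree v~w
    where own = ∈-own-component simple v~w

-- The branches of a star at its centre

blockIndex : (ps : List Pointed) → Fin (total ps) → ℕ
blockIndex (p ∷ ps) x with splitAt (size p) x
... | inj₁ _ = 0
... | inj₂ y = suc (blockIndex ps y)

block : (ps : List Pointed) → ℕ → Subset (total ps)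
block []       _       = []
block (p ∷ ps) zero    = ⊤ {n = size p} ++ ∅ {n = total ps}
block (p ∷ ps) (suc j) = ∅ {n = size p} ++ block ps j

blockIndex-↑ˡ : ∀ p ps i → blockIndex (p ∷ ps) (i ↑ˡ total ps) ≡ 0
blockIndex-↑ˡ p ps i rewrite splitAt-↑ˡ (size p) i (total ps) = refl

blockIndex-↑ʳ : ∀ p ps j → blockIndex (p ∷ ps) (size p ↑ʳ j) ≡ suc (blockIndex ps j)
blockIndex-↑ʳ p ps j rewrite splitAt-↑ʳ (size p) (total ps) j = refl

∈-block⁺ : ∀ ps x → x ∈ block ps (blockIndex ps x)
∈-block⁺ (p ∷ ps) x with splitAt (size p) x in x↦
... | inj₁ i = subst (_∈ block (p ∷ ps) 0) (splitAt⁻¹-↑ˡ x↦) (∈-++⁺ˡ ∈⊤)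
... | inj₂ j = subst (_∈ block (p ∷ ps) (suc (blockIndex ps j))) (splitAt⁻¹-↑ʳ x↦) (∈-++⁺ʳ ∅ (∈-block⁺ ps j))

∈-block⁻ : ∀ ps {j} x → x ∈ block ps j → blockIndex ps x ≡ j
∈-block⁻ (p ∷ ps) {zero} x x∈ with splitAt (size p) x in x↦
... | inj₁ _ = refl
... | inj₂ y = contradiction (∈-++⁻ʳ (⊤ {n = size p}) (subst (_∈ block (p ∷ ps) 0) (sym (splitAt⁻¹-↑ʳ x↦)) x∈)) ∉⊥
∈-block⁻ (p ∷ ps) {suc j} x x∈ with splitAt (size p) x in x↦
... | inj₁ i = contradiction (∈-++⁻ˡ (subst (_∈ block (p ∷ ps) (suc j)) (sym (splitAt⁻¹-↑ˡ x↦)) x∈)) ∉⊥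
... | inj₂ y = cong suc (∈-block⁻ ps y (∈-++⁻ʳ ∅ (subst (_∈ block (p ∷ ps) (suc j)) (sym (splitAt⁻¹-↑ʳ x↦)) x∈)))

∣block∣-head : ∀ p ps → ∣ block (p ∷ ps) 0 ∣ ≡ size p
∣block∣-head p ps = trans (∣p++q∣≡∣p∣+∣q∣ (⊤ {n = size p}) ∅)
                          (trans (cong₂ _+_ (∣⊤∣≡n (size p)) (∣⊥∣≡0 (total ps))) (+-identityʳ (size p)))

∣block∣-tail : ∀ p ps j → ∣ block (p ∷ ps) (suc j) ∣ ≡ ∣ block ps j ∣
∣block∣-tail p ps j =
  trans (∣p++q∣≡∣p∣+∣q∣ (∅ {n = size p}) (block ps j)) (cong (_+ ∣ block ps j ∣) (∣⊥∣≡0 (size p)))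

unionAdj-↑ˡ : ∀ p ps a b → unionAdj (p ∷ ps) (a ↑ˡ total ps) (b ↑ˡ total ps) ≡ graph p a b
unionAdj-↑ˡ p ps a b rewrite splitAt-↑ˡ (size p) a (total ps) | splitAt-↑ˡ (size p) b (total ps) = refl

unionAdj-↑ʳ : ∀ p ps a b → unionAdj (p ∷ ps) (size p ↑ʳ a) (size p ↑ʳ b) ≡ unionAdj ps a b
unionAdj-↑ʳ p ps a b rewrite splitAt-↑ʳ (size p) (total ps) a | splitAt-↑ʳ (size p) (total ps) b = refl

unionAdj-blockIndex : ∀ ps {x y} → unionAdj ps x y ≡ true → blockIndex ps x ≡ blockIndex ps y
unionAdj-blockIndex (p ∷ ps) {x} {y} x~y with splitAt (size p) x | splitAt (size p) y
... | inj₁ _ | inj₁ _ = refl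
... | inj₂ a | inj₂ b = cong suc (unionAdj-blockIndex ps x~y)

block-connected : ∀ ps → All (Connected ∘ graph) ps →
  ∀ x y → blockIndex ps x ≡ blockIndex ps y → Reach (unionAdj ps) ⊤ x y
block-connected (p ∷ ps) (connected ∷ _) x y same with splitAt (size p) x in x↦ | splitAt (size p) y in y↦
... | inj₁ a | inj₁ b = subst₂ (Reach (unionAdj (p ∷ ps)) ⊤) (splitAt⁻¹-↑ˡ x↦) (splitAt⁻¹-↑ˡ y↦)
  (reach-map (_↑ˡ total ps) (λ _ → ∈⊤) (λ {a} {b} e → trans (unionAdj-↑ˡ p ps a b) e) (connected a b))
block-connected (p ∷ ps) (_ ∷ connected) x y same | inj₂ a | inj₂ b =
  subst₂ (Reach (unionAdj (p ∷ ps)) ⊤) (splitAt⁻¹-↑ʳ x↦) (splitAt⁻¹-↑ʳ y↦)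
  (reach-map (size p ↑ʳ_) (λ _ → ∈⊤) (λ {a} {b} e → trans (unionAdj-↑ʳ p ps a b) e)
    (block-connected ps connected a b (suc-injective same)))

module _ (ps : List Pointed) (connected : All (Connected ∘ graph) ps) where

  open Components (star ps)

  star-component : ∀ x → component (⊤ - zero) (suc x) ≡ outside ∷ block ps (blockIndex ps x)
  star-component x = ⊆-antisym (in-block ∘ ∈-component⁻) from-block
    where
    SameBlock : Fin (suc (total ps)) → Set
    SameBlock z = ∃ λ y → z ≡ suc y × blockIndex ps y ≡ blockIndex ps x

    step-SameBlock : ∀ {a b} → SameBlock a → star ps a b ≡ true → b ∈ ⊤ - zero → SameBlock b
    step-SameBlock {b = zero}  _                  _   b∈ = contradiction refl (x∈p-y⇒x≢y {p = ⊤} b∈)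
    step-SameBlock {b = suc b} (y , refl , same) y~b _  = b , refl , trans (sym (unionAdj-blockIndex ps y~b)) same

    in-block : ∀ {z} → Reach (star ps) (⊤ - zero) (suc x) z → z ∈ outside ∷ block ps (blockIndex ps x)
    in-block x⇝z with reach-invariant SameBlock step-SameBlock (x , refl , refl) x⇝z
    ... | y , refl , same = there (subst (λ j → y ∈ block ps j) same (∈-block⁺ ps y))

    from-block : ∀ {z} → z ∈ outside ∷ block ps (blockIndex ps x) → z ∈ component (⊤ - zero) (suc x)
    from-block {suc y} (there y∈) = ∈-component⁺ (reach-map suc (λ {z} _ → x∈p∧x≢y⇒x∈p-y {y = zero} ∈⊤ λ ()) id
      (block-connected ps connected x y (sym (∈-block⁻ ps y y∈))))

  ∈-star-component : ∀ {x y} → blockIndex ps y ≡ blockIndex ps x → suc y ∈ component (⊤ - zero) (suc x)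
  ∈-star-component {x} {y} same =
    subst (suc y ∈_) (sym (star-component x)) (there (subst (λ j → y ∈ block ps j) same (∈-block⁺ ps y)))

  ∣star-component∣ : ∀ x → ∣ component (⊤ - zero) (suc x) ∣ ≡ ∣ block ps (blockIndex ps x) ∣
  ∣star-component∣ x = cong ∣_∣ (star-component x)

block-small : ∀ ps → All (λ p → size p ≤ g) ps → ∀ j → ∣ block ps j ∣ ≤ g
block-small []       []          j       = z≤n
block-small (p ∷ ps) (p≤g ∷ _)   zero    = subst (_≤ _) (sym (∣block∣-head p ps)) p≤g
block-small (p ∷ ps) (_ ∷ ps≤g) (suc j) = subst (_≤ _) (sym (∣block∣-tail p ps j)) (block-small ps ps≤g j)

isRoot-root : ∀ p ps → isRoot (p ∷ ps) (root p ↑ˡ total ps) ≡ true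
isRoot-root p ps rewrite splitAt-↑ˡ (size p) (root p) (total ps) = dec-true (root p ≟ᶠ root p) refl

isRoot-↑ʳ : ∀ p ps j → isRoot (p ∷ ps) (size p ↑ʳ j) ≡ isRoot ps j
isRoot-↑ʳ p ps j rewrite splitAt-↑ʳ (size p) (total ps) j = refl

star-centre : ∀ {T′ T″ Ts} → size T′ ≡ suc g → IsTree (graph T′) → size T″ ≡ suc g → IsTree (graph T″) →
  All (λ Ti → (1 ≤ size Ti) × (size Ti ≤ g) × IsTree (graph Ti)) Ts → Centre (star (T′ ∷ T″ ∷ Ts)) g
star-centre {g} {T′} {T″} {Ts} ∣T′∣ T′-tree ∣T″∣ T″-tree Ts-small = record
  { centre       = zero
  ; left         = suc l
  ; right        = suc r
  ; centre~left  = isRoot-root T′ (T″ ∷ Ts)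
  ; centre~right = trans (isRoot-↑ʳ T′ (T″ ∷ Ts) (root T″ ↑ˡ total Ts)) (isRoot-root T″ Ts)
  ; separated    = separated
  ; ∣left∣       = trans (∣star-component∣ ps connected l)
                     (trans (cong (∣_∣ ∘ block ps) l-block) (trans (∣block∣-head T′ (T″ ∷ Ts)) ∣T′∣))
  ; ∣right∣      = trans (∣star-component∣ ps connected r)
                     (trans (cong (∣_∣ ∘ block ps) r-block)
                       (trans (∣block∣-tail T′ (T″ ∷ Ts) 0) (trans (∣block∣-head T″ Ts) ∣T″∣)))
  ; small        = small
  }
  where
  open Components (star (T′ ∷ T″ ∷ Ts))
  ps = T′ ∷ T″ ∷ Ts
  l = root T′ ↑ˡ total (T″ ∷ Ts)
  r = size T′ ↑ʳ (root T″ ↑ˡ total Ts)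

  l-block : blockIndex ps l ≡ 0
  l-block = blockIndex-↑ˡ T′ (T″ ∷ Ts) (root T′)

  r-block : blockIndex ps r ≡ 1
  r-block = trans (blockIndex-↑ʳ T′ (T″ ∷ Ts) (root T″ ↑ˡ total Ts)) (cong suc (blockIndex-↑ˡ T″ Ts (root T″)))

  connected : All (Connected ∘ graph) ps
  connected = proj₁ (proj₂ T′-tree) ∷ proj₁ (proj₂ T″-tree) ∷
              All.map (λ (_ , _ , tree) → proj₁ (proj₂ tree)) Ts-small

  separated : ¬ Reach (star ps) (⊤ - zero) (suc l) (suc r)
  separated l⇝r with subst (suc r ∈_) (star-component ps connected l) (∈-component⁺ l⇝r)
  ... | there r∈ = contradiction (trans (sym r-block) (trans (∈-block⁻ ps r r∈) l-block)) λ ()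

  small : ∀ {x} → zero ≢ x → x ∉ component (⊤ - zero) (suc l) → x ∉ component (⊤ - zero) (suc r) →
    ∣ component (⊤ - zero) x ∣ ≤ g
  small {zero}  0≢0 _ _ = contradiction refl 0≢0
  small {suc y} _ y∉L y∉R with blockIndex ps y in y-block
  ... | zero        = contradiction (∈-star-component ps connected (trans y-block (sym l-block))) y∉L
  ... | suc zero    = contradiction (∈-star-component ps connected (trans y-block (sym r-block))) y∉R
  ... | suc (suc j) = subst (_≤ g)
    (sym (trans (∣star-component∣ ps connected y)
      (trans (cong (∣_∣ ∘ block ps) y-block) (trans (∣block∣-tail T′ (T″ ∷ Ts) (suc j)) (∣block∣-tail T″ Ts j)))))
    (block-small Ts (All.map (proj₁ ∘ proj₂) Ts-small) j)

decomposition⇒kappa : ∀ {T : Graph n} → IsTree T → StarDecomposition g T →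
  HasRgCutsetWithKappa T g (n ∸ (2 * g + 2))
decomposition⇒kappa {g = g} (simple , connected , _)
                    (T′ , T″ , Ts , ∣T′∣ , T′-tree , ∣T″∣ , T″-tree , Ts-small , _ , iso) =
  Iso-kappa iso (subst (λ N → HasRgCutsetWithKappa H g (N ∸ (2 * g + 2))) (sym (Iso⇒≡ {H = H} iso))
    (centre⇒kappa (Iso-Simple {H = H} iso simple) (Iso-Connected {H = H} iso connected)
      (star-centre ∣T′∣ T′-tree ∣T″∣ T″-tree Ts-small)))
  where H = star (T′ ∷ T″ ∷ Ts)

theorem4p3 : (n g : ℕ) → 3 ≤ n → g ≤ (n ∸ 3) / 2 →
    (T : Graph n) → IsTree T →
    HasRgCutsetWithKappa T g (n ∸ (2 * g + 2)) ⇔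
      (Σ Pointed λ T′ → Σ Pointed λ T″ → Σ (List Pointed) λ Ts →
        (size T′ ≡ suc g) × IsTree (graph T′) ×
        (size T″ ≡ suc g) × IsTree (graph T″) ×
        All (λ Ti → (1 ≤ size Ti) × (size Ti ≤ g) × IsTree (graph Ti)) Ts ×
        (total Ts ≡ n ∸ (2 * g + 3)) ×
        Iso T (star (T′ ∷ T″ ∷ Ts)))
theorem4p3 n g _ _ _ tree = mk⇔ (centre⇒decomposition tree ∘ kappa⇒centre tree) (decomposition⇒kappa tree)
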